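{- Let $R$ be a principal ideal domain and $\Lambda_1,\Lambda_2$ free $R$-modules of ranks $2m$ and $2n$, each with an alternating bilinear form, and let $\Lambda=\Lambda_1\perp\Lambda_2$ with the orthogonal sum form $\langle\,,\rangle$; assume $\Lambda,\Lambda_1,\Lambda_2$ are non-degenerate. Let $\pi_1,\pi_2$ be the projections of $\Lambda$ onto $\Lambda_1,\Lambda_2$, let $X$ be a maximal totally isotropic submodule of $\Lambda$, $X_i=\pi_i(X)$, and put $2r:=\operatorname{rk}(X_1/\operatorname{rad}(X_1))=\operatorname{rk}(X_2/\operatorname{rad}(X_2))$, $m_1=\operatorname{rk}(\operatorname{rad}(X_1))$, $n_1=\operatorname{rk}(\operatorname{rad}(X_2))$. Then $m_1=m-r$ and $n_1=n-r$.
   Context: $\operatorname{rad}(Y)=\{y\in Y:\langle y,Y\rangle=0\}$. A submodule is totally isotropic if the form vanishes on it; maximal means maximal with respect to inclusion among totally isotropic submodules. -}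

module Defs where

open import Level using (Level; _⊔_)
open import Algebra.Bundles using (CommutativeRing)
import Data.Nat as ℕ
open import Data.Fin using (Fin; zero; suc)
open import Data.Product using (Σ; _×_; _,_; proj₁; proj₂)
open import Data.Sum using (_⊎_)
open import Relation.Nullary using (¬_)
open import Relation.Unary using (Pred; _⊆_)

module _ {c ℓ : Level} (R : CommutativeRing c ℓ) where
  open CommutativeRing R renaming (Carrier to A) hiding (zero)

  IsIntegralDomain : Set (c ⊔ ℓ)
  IsIntegralDomain = (¬ (1# ≈ 0#)) × (∀ x y → x * y ≈ 0# → (x ≈ 0#) ⊎ (y ≈ 0#))

  IsIdeal : Pred A (c ⊔ ℓ) → Set (c ⊔ ℓ)
  IsIdeal I = (∀ {x y} → x ≈ y → I x → I y)
            × I 0#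
            × (∀ {x y} → I x → I y → I (x + y))
            × (∀ r {x} → I x → I (r * x))

  IsPrincipal : Pred A (c ⊔ ℓ) → Set (c ⊔ ℓ)
  IsPrincipal I = Σ A λ a → ∀ x → (I x → Σ A λ r → x ≈ r * a) × ((Σ A λ r → x ≈ r * a) → I x)

  IsPID : Set (Level.suc (c ⊔ ℓ))
  IsPID = IsIntegralDomain × (∀ (I : Pred A (c ⊔ ℓ)) → IsIdeal I → IsPrincipal I)

  -- the free R-module of rank k, realised as R^k = Fin k → R
  V : ℕ.ℕ → Set c
  V k = Fin k → A

  _≈v_ : ∀ {k} → V k → V k → Set ℓ
  u ≈v v = ∀ i → u i ≈ v i

  0v : ∀ {k} → V k
  0v i = 0#

  _+v_ : ∀ {k} → V k → V k → V k
  (u +v v) i = u i + v i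

  _·v_ : ∀ {k} → A → V k → V k
  (a ·v v) i = a * v i

  lincomb : ∀ {k N} → (Fin k → A) → (Fin k → V N) → V N
  lincomb {ℕ.zero}  a v = 0v
  lincomb {ℕ.suc k} a v = (a zero ·v v zero) +v lincomb (λ i → a (suc i)) (λ i → v (suc i))

  -- Λ = Λ₁ ⊥ Λ₂ with Λ₁ = R^p, Λ₂ = R^q, realised as pairs
  V₂ : ℕ.ℕ → ℕ.ℕ → Set c
  V₂ p q = V p × V q

  _≈₂_ : ∀ {p q} → V₂ p q → V₂ p q → Set ℓ
  (x₁ , x₂) ≈₂ (y₁ , y₂) = (x₁ ≈v y₁) × (x₂ ≈v y₂)

  -- generic linear-structure data on a carrier, to define submodules uniformly
  record LinOps (W : Set c) : Set (c ⊔ Level.suc ℓ) where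
    field
      _≈W_ : W → W → Set ℓ
      0W   : W
      _+W_ : W → W → W
      _·W_ : A → W → W

  vecOps : ∀ k → LinOps (V k)
  vecOps k = record { _≈W_ = _≈v_ ; 0W = 0v ; _+W_ = _+v_ ; _·W_ = _·v_ }

  pairOps : ∀ p q → LinOps (V₂ p q)
  pairOps p q = record
    { _≈W_ = _≈₂_
    ; 0W   = (0v , 0v)
    ; _+W_ = λ x y → (proj₁ x +v proj₁ y , proj₂ x +v proj₂ y)
    ; _·W_ = λ a x → (a ·v proj₁ x , a ·v proj₂ x)
    }

  IsSubmodule : ∀ {W} → LinOps W → Pred W (c ⊔ ℓ) → Set (c ⊔ ℓ)
  IsSubmodule ops M = (∀ {x y} → x ≈W y → M x → M y)
                    × M 0W
                    × (∀ {x y} → M x → M y → M (x +W y))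
                    × (∀ a {x} → M x → M (a ·W x))
    where open LinOps ops

  IsAltBilinear : ∀ {W} → LinOps W → (W → W → A) → Set (c ⊔ ℓ)
  IsAltBilinear ops B =
      (∀ {x x' y y'} → x ≈W x' → y ≈W y' → B x y ≈ B x' y')
    × (∀ x x' y → B (x +W x') y ≈ B x y + B x' y)
    × (∀ a x y → B (a ·W x) y ≈ a * B x y)
    × (∀ x y y' → B x (y +W y') ≈ B x y + B x y')
    × (∀ a x y → B x (a ·W y) ≈ a * B x y)
    × (∀ x → B x x ≈ 0#)
    where open LinOps ops

  NonDegenerate : ∀ {W} → LinOps W → (W → W → A) → Set (c ⊔ ℓ)
  NonDegenerate ops B = ∀ x → (∀ y → B x y ≈ 0#) → x ≈W 0W
    where open LinOps ops

  orthSum : ∀ {p q} → (V p → V p → A) → (V q → V q → A) → V₂ p q → V₂ p q → A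
  orthSum B₁ B₂ (x₁ , x₂) (y₁ , y₂) = B₁ x₁ y₁ + B₂ x₂ y₂

  TotallyIsotropic : ∀ {W : Set c} → (W → W → A) → Pred W (c ⊔ ℓ) → Set (c ⊔ ℓ)
  TotallyIsotropic B X = ∀ x y → X x → X y → B x y ≈ 0#

  MaximalTotallyIsotropic : ∀ {W} → LinOps W → (W → W → A) → Pred W (c ⊔ ℓ) → Set (Level.suc (c ⊔ ℓ))
  MaximalTotallyIsotropic ops B X =
      IsSubmodule ops X × TotallyIsotropic B X
    × (∀ (Y : Pred _ (c ⊔ ℓ)) → IsSubmodule ops Y → TotallyIsotropic B Y → X ⊆ Y → Y ⊆ X)

  image₁ : ∀ {p q} → Pred (V₂ p q) (c ⊔ ℓ) → Pred (V p) (c ⊔ ℓ)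
  image₁ X x = Σ (V₂ _ _) λ z → X z × (proj₁ z ≈v x)

  image₂ : ∀ {p q} → Pred (V₂ p q) (c ⊔ ℓ) → Pred (V q) (c ⊔ ℓ)
  image₂ X x = Σ (V₂ _ _) λ z → X z × (proj₂ z ≈v x)

  rad : ∀ {k} → (V k → V k → A) → Pred (V k) (c ⊔ ℓ) → Pred (V k) (c ⊔ ℓ)
  rad B Y x = Y x × (∀ y → Y y → B x y ≈ 0#)

  zeroSub : ∀ {k} → Pred (V k) (c ⊔ ℓ)
  zeroSub x = Level.Lift (c ⊔ ℓ) (x ≈v 0v)

  IndependentMod : ∀ {k N} → Pred (V N) (c ⊔ ℓ) → (Fin k → V N) → Set (c ⊔ ℓ)
  IndependentMod S v = ∀ a → S (lincomb a v) → ∀ i → a i ≈ 0#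

  -- rk(M/S) = k : maximal number of elements of M/S that are linearly independent
  HasRankMod : ∀ {N} → Pred (V N) (c ⊔ ℓ) → Pred (V N) (c ⊔ ℓ) → ℕ.ℕ → Set (c ⊔ ℓ)
  HasRankMod {N} M S k =
      (Σ (Fin k → V N) λ v → (∀ i → M (v i)) × IndependentMod S v)
    × (∀ (v : Fin (ℕ.suc k) → V N) → (∀ i → M (v i)) → ¬ IndependentMod S v)

  HasRank : ∀ {N} → Pred (V N) (c ⊔ ℓ) → ℕ.ℕ → Set (c ⊔ ℓ)
  HasRank M k = HasRankMod M zeroSub k

-- Maximality makes each projection Xᵢ coisotropic: if y ⊥ X₁ then (y, 0) ⊥ X, so
-- (y, 0) ∈ X.  For a coisotropic submodule W of a non-degenerate alternating space of
-- rank N, with rk rad W = m₁ and rk (W / rad W) = k, one has 2 m₁ + k = N.  Indeed, a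
-- basis of rad W is orthogonal, for the standard dot product, to the images under the
-- injective map y ↦ B(−, y) of m₁ + k independent vectors of W, whence 2 m₁ + k ≤ N;
-- and the annihilator of those m₁ + k vectors, of rank ≥ N − m₁ − k, is orthogonal to W,
-- hence lies in W^⊥ ∩ W = rad W, whence N − m₁ − k ≤ m₁.  Both rank estimates are by
-- Gaussian elimination over the integral domain R; the classical reasoning they need is
-- available because every ideal of R, even one defined by an arbitrary proposition, is
-- principal.
module Submission where

open import Defs
open import Level using (Level; _⊔_; Lift; lift; lower)
open import Algebra.Bundles using (CommutativeRing)
open import Data.Nat as ℕ using (ℕ; zero; suc; _≤_; _≤?_; s≤s)
import Data.Nat.Properties as ℕₚ
open import Data.Fin using (Fin; zero; suc; punchIn; _↑ˡ_; _↑ʳ_; splitAt; join)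
open import Data.Fin.Properties using (all?; ¬∀⟶∃¬; join-splitAt; _≟_; punchIn-punchOut)
open import Data.Vec.Functional using (_++_; _∷_; insertAt)
open import Data.Vec.Functional.Properties using (lookup-++ˡ; lookup-++ʳ; insertAt-lookup; insertAt-punchIn)
open import Data.Product using (Σ; _×_; _,_; proj₁; proj₂)
open import Data.Sum using (_⊎_; inj₁; inj₂; [_,_])
open import Data.Empty using (⊥-elim)
open import Function using (_∘_)
open import Relation.Nullary using (¬_; Dec; yes; no)
open import Relation.Nullary.Decidable using (decidable-stable; map′)
open import Relation.Unary using (Pred; _⊆_)
open import Relation.Binary.Definitions using (Decidable)
open import Relation.Binary.PropositionalEquality as ≡ using (_≡_)

↑ˡ-↑ʳ-elim : ∀ {p} m n (P : Fin (m ℕ.+ n) → Set p) →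
              (∀ i → P (i ↑ˡ n)) → (∀ j → P (m ↑ʳ j)) → ∀ i → P i
↑ˡ-↑ʳ-elim m n P Pˡ Pʳ i = ≡.subst P (join-splitAt m n i) ([_,_] {C = P ∘ join m n} Pˡ Pʳ (splitAt m i))

module _ {c ℓ : Level} (R : CommutativeRing c ℓ) where
  open CommutativeRing R renaming (Carrier to A) hiding (zero)
  open import Algebra.Properties.Semiring.Sum semiring
    using (sum; sum-cong-≋; sum-remove; ∑-distrib-+; ∑-comm; sum-replicate-zero; *-distribˡ-sum; *-distribʳ-sum)
  open import Algebra.Properties.Ring ring using (-‿distribˡ-*; -1*x≈-x)
  open import Algebra.Properties.CommutativeSemigroup +-commutativeSemigroup using (interchange)
  open import Algebra.Solver.Ring.NaturalCoefficients.Default commutativeSemiring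
  open import Relation.Binary.Reasoning.Setoid setoid

  infix  4 _≈ᵛ_
  infixl 6 _+ᵛ_
  infixr 7 _·ᵛ_

  _≈ᵛ_ : ∀ {N} → V R N → V R N → Set ℓ
  _≈ᵛ_ = _≈v_ R

  _+ᵛ_ : ∀ {N} → V R N → V R N → V R N
  _+ᵛ_ = _+v_ R

  _·ᵛ_ : ∀ {N} → A → V R N → V R N
  _·ᵛ_ = _·v_ R

  0ᵛ : ∀ {N} → V R N
  0ᵛ = 0v R

  sum-zero : ∀ {k} (f : Fin k → A) → (∀ i → f i ≈ 0#) → sum f ≈ 0#
  sum-zero {k} f f≈0 = trans (sum-cong-≋ f≈0) (sum-replicate-zero k)

  x+y≈0⇒y≈-1*x : ∀ {x y} → x + y ≈ 0# → y ≈ - 1# * x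
  x+y≈0⇒y≈-1*x {x} {y} x+y≈0 = begin
    y              ≈⟨ sym (+-identityˡ y) ⟩
    0# + y         ≈⟨ +-congʳ (sym (-‿inverseˡ x)) ⟩
    (- x + x) + y  ≈⟨ +-assoc (- x) x y ⟩
    - x + (x + y)  ≈⟨ +-congˡ x+y≈0 ⟩
    - x + 0#       ≈⟨ +-identityʳ (- x) ⟩
    - x            ≈⟨ sym (-1*x≈-x x) ⟩
    - 1# * x       ∎

  x*y+-y*x≈0 : ∀ x y → x * y + (- y) * x ≈ 0#
  x*y+-y*x≈0 x y = begin
    x * y + (- y) * x   ≈⟨ +-congˡ (sym (-‿distribˡ-* y x)) ⟩
    x * y + - (y * x)   ≈⟨ +-congˡ (-‿cong (*-comm y x)) ⟩
    x * y + - (x * y)   ≈⟨ -‿inverseʳ (x * y) ⟩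
    0#                  ∎

  lincomb-pointwise : ∀ {k N} (a : Fin k → A) (v : Fin k → V R N) t →
                      lincomb R a v t ≈ sum (λ j → a j * v j t)
  lincomb-pointwise {zero}  a v t = refl
  lincomb-pointwise {suc k} a v t = +-congˡ (lincomb-pointwise (a ∘ suc) (v ∘ suc) t)

  lincomb-congˡ : ∀ {k N} {a b : Fin k → A} (v : Fin k → V R N) →
                  (∀ i → a i ≈ b i) → lincomb R a v ≈ᵛ lincomb R b v
  lincomb-congˡ {zero}  v a≈b t = refl
  lincomb-congˡ {suc k} v a≈b t = +-cong (*-congʳ (a≈b zero)) (lincomb-congˡ (v ∘ suc) (a≈b ∘ suc) t)

  lincomb-congʳ : ∀ {k N} (a : Fin k → A) {u v : Fin k → V R N} →
                  (∀ i → u i ≈ᵛ v i) → lincomb R a u ≈ᵛ lincomb R a v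
  lincomb-congʳ {zero}  a u≈v t = refl
  lincomb-congʳ {suc k} a u≈v t = +-cong (*-congˡ (u≈v zero t)) (lincomb-congʳ (a ∘ suc) (u≈v ∘ suc) t)

  lincomb-zeroˡ : ∀ {k N} {a : Fin k → A} (v : Fin k → V R N) → (∀ i → a i ≈ 0#) → lincomb R a v ≈ᵛ 0ᵛ
  lincomb-zeroˡ {a = a} v a≈0 t = trans (lincomb-congˡ v a≈0 t)
    (trans (lincomb-pointwise (λ _ → 0#) v t) (sum-zero _ (λ j → zeroˡ (v j t))))

  lincomb-reindex : ∀ {k M N} (a : Fin k → A) (v : Fin k → V R N) (f : Fin M → Fin N) →
                    lincomb R a (λ i → v i ∘ f) ≈ᵛ lincomb R a v ∘ f
  lincomb-reindex {zero}  a v f t = refl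
  lincomb-reindex {suc k} a v f t = +-congˡ (lincomb-reindex (a ∘ suc) (v ∘ suc) f t)

  lincomb-splitAt : ∀ m {k N} (a : Fin (m ℕ.+ k) → A) (v : Fin (m ℕ.+ k) → V R N) →
                    lincomb R a v ≈ᵛ lincomb R (a ∘ (_↑ˡ k)) (v ∘ (_↑ˡ k)) +ᵛ lincomb R (a ∘ (m ↑ʳ_)) (v ∘ (m ↑ʳ_))
  lincomb-splitAt zero    a v t = sym (+-identityˡ _)
  lincomb-splitAt (suc m) a v t =
    trans (+-congˡ (lincomb-splitAt m (a ∘ suc) (v ∘ suc) t)) (sym (+-assoc _ _ _))

  lincomb-++ : ∀ {m k N} (a : Fin (m ℕ.+ k) → A) (s : Fin m → V R N) (q : Fin k → V R N) →
               lincomb R a (s ++ q) ≈ᵛ lincomb R (a ∘ (_↑ˡ k)) s +ᵛ lincomb R (a ∘ (m ↑ʳ_)) q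
  lincomb-++ {m} a s q t = trans (lincomb-splitAt m a (s ++ q) t)
    (+-cong (lincomb-congʳ (a ∘ (_↑ˡ _)) (λ i _ → reflexive (≡.cong-app (lookup-++ˡ s q i) _)) t)
            (lincomb-congʳ (a ∘ (m ↑ʳ_)) (λ j _ → reflexive (≡.cong-app (lookup-++ʳ s q j) _)) t))

  lincomb-closed : ∀ {k N} {S : Pred (V R N) (c ⊔ ℓ)} → IsSubmodule R (vecOps R N) S →
                   (a : Fin k → A) (v : Fin k → V R N) → (∀ i → S (v i)) → S (lincomb R a v)
  lincomb-closed {zero}  (_ , S0 , _ , _) a v Sv = S0
  lincomb-closed {suc k} subS@(_ , _ , S+ , S·) a v Sv =
    S+ (S· (a zero) (Sv zero)) (lincomb-closed subS (a ∘ suc) (v ∘ suc) (Sv ∘ suc))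

  dot : ∀ {N} → V R N → V R N → A
  dot x y = sum (λ l → x l * y l)

  dot-comm : ∀ {N} (x y : V R N) → dot x y ≈ dot y x
  dot-comm x y = sum-cong-≋ (λ l → *-comm (x l) (y l))

  dot-zeroʳ : ∀ {N} (x y : V R N) → y ≈ᵛ 0ᵛ → dot x y ≈ 0#
  dot-zeroʳ x y y≈0 = sum-zero _ (λ l → trans (*-congˡ (y≈0 l)) (zeroʳ (x l)))

  dot-punchIn : ∀ {N} (x y : V R (suc N)) l → dot x y ≈ x l * y l + dot (x ∘ punchIn l) (y ∘ punchIn l)
  dot-punchIn x y l = sum-remove {i = l} (λ t → x t * y t)

  dot-lincombʳ : ∀ {k N} (x : V R N) (b : Fin k → A) (v : Fin k → V R N) →
                 dot x (lincomb R b v) ≈ sum (λ j → b j * dot x (v j))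
  dot-lincombʳ x b v = begin
    sum (λ l → x l * lincomb R b v l)              ≈⟨ sum-cong-≋ (λ l → *-congˡ (lincomb-pointwise b v l)) ⟩
    sum (λ l → x l * sum (λ j → b j * v j l))      ≈⟨ sum-cong-≋ (λ l → *-distribˡ-sum (x l) (λ j → b j * v j l)) ⟩
    sum (λ l → sum (λ j → x l * (b j * v j l)))    ≈⟨ ∑-comm (λ l j → x l * (b j * v j l)) ⟩
    sum (λ j → sum (λ l → x l * (b j * v j l)))    ≈⟨ sum-cong-≋ (λ j → sum-cong-≋ (λ l → x*[y*z]≈y*[x*z] (x l) (b j) (v j l))) ⟩
    sum (λ j → sum (λ l → b j * (x l * v j l)))    ≈⟨ sum-cong-≋ (λ j → sym (*-distribˡ-sum (b j) (λ l → x l * v j l))) ⟩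
    sum (λ j → b j * dot x (v j))                  ∎
    where
    x*[y*z]≈y*[x*z] : ∀ x y z → x * (y * z) ≈ y * (x * z)
    x*[y*z]≈y*[x*z] = solve 3 (λ x y z → x :* (y :* z) := y :* (x :* z)) refl

  dot-linearʳ : ∀ {N} (x y z : V R N) a b → dot x (a ·ᵛ y +ᵛ b ·ᵛ z) ≈ a * dot x y + b * dot x z
  dot-linearʳ x y z a b = begin
    sum (λ l → x l * (a * y l + b * z l))                       ≈⟨ sum-cong-≋ (λ l → expand (x l) (y l) (z l) a b) ⟩
    sum (λ l → a * (x l * y l) + b * (x l * z l))               ≈⟨ ∑-distrib-+ (λ l → a * (x l * y l)) (λ l → b * (x l * z l)) ⟩
    sum (λ l → a * (x l * y l)) + sum (λ l → b * (x l * z l))   ≈⟨ sym (+-cong (*-distribˡ-sum a (λ l → x l * y l)) (*-distribˡ-sum b (λ l → x l * z l))) ⟩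
    a * dot x y + b * dot x z                                   ∎
    where
    expand : ∀ p q r s t → p * (s * q + t * r) ≈ s * (p * q) + t * (p * r)
    expand = solve 5 (λ p q r s t → p :* (s :* q :+ t :* r) := s :* (p :* q) :+ t :* (p :* r)) refl

  dot-linearˡ : ∀ {N} (x y z : V R N) a b → dot (a ·ᵛ y +ᵛ b ·ᵛ z) x ≈ a * dot y x + b * dot z x
  dot-linearˡ x y z a b = trans (dot-comm _ x) (trans (dot-linearʳ x y z a b)
    (+-cong (*-congˡ (dot-comm x y)) (*-congˡ (dot-comm x z))))

  basis : ∀ {N} → Fin N → V R N
  basis zero    zero    = 1#
  basis zero    (suc t) = 0#
  basis (suc l) zero    = 0#
  basis (suc l) (suc t) = basis l t

  basis-diagonal : ∀ {N} (l : Fin N) → basis l l ≡ 1#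
  basis-diagonal zero    = ≡.refl
  basis-diagonal (suc l) = basis-diagonal l

  basis-sym : ∀ {N} (l t : Fin N) → basis l t ≡ basis t l
  basis-sym zero    zero    = ≡.refl
  basis-sym zero    (suc t) = ≡.refl
  basis-sym (suc l) zero    = ≡.refl
  basis-sym (suc l) (suc t) = basis-sym l t

  sum-*basis : ∀ {N} (a : V R N) t → sum (λ l → a l * basis l t) ≈ a t
  sum-*basis {suc N} a zero = begin
    a zero * 1# + sum (λ l → a (suc l) * 0#)   ≈⟨ +-cong (*-identityʳ _) (sum-zero (λ l → a (suc l) * 0#) (λ l → zeroʳ _)) ⟩
    a zero + 0#                                ≈⟨ +-identityʳ _ ⟩
    a zero                                     ∎
  sum-*basis {suc N} a (suc t) = begin
    a zero * 0# + sum (λ l → a (suc l) * basis l t)  ≈⟨ +-cong (zeroʳ _) (sum-*basis (a ∘ suc) t) ⟩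
    0# + a (suc t)                                   ≈⟨ +-identityˡ _ ⟩
    a (suc t)                                        ∎

  lincomb-basis : ∀ {N} (a : V R N) → lincomb R a basis ≈ᵛ a
  lincomb-basis a t = trans (lincomb-pointwise a basis t) (sum-*basis a t)

  ≈ᵛ-punchIn : ∀ {N} (x y : V R (suc N)) l → x l ≈ y l → (x ∘ punchIn l) ≈ᵛ (y ∘ punchIn l) → x ≈ᵛ y
  ≈ᵛ-punchIn x y l xl≈yl x≈y t with t ≟ l
  ... | yes ≡.refl = xl≈yl
  ... | no t≢l rewrite ≡.sym (punchIn-punchOut {i = l} {j = t} (t≢l ∘ ≡.sym)) = x≈y _

  -- Linear independence

  Independent : ∀ {k N} → (Fin k → V R N) → Set (c ⊔ ℓ)
  Independent v = ∀ a → lincomb R a v ≈ᵛ 0ᵛ → ∀ i → a i ≈ 0#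

  independentMod-zero⇒independent : ∀ {k N} {v : Fin k → V R N} → IndependentMod R (zeroSub R) v → Independent v
  independentMod-zero⇒independent v-ind a lc≈0 = v-ind a (lift lc≈0)

  independent⇒independentMod-zero : ∀ {k N} {v : Fin k → V R N} → Independent v → IndependentMod R (zeroSub R) v
  independent⇒independentMod-zero v-ind a lc≈0 = v-ind a (lower lc≈0)

  basis-independent : ∀ {N} → Independent (basis {N})
  basis-independent a lc≈0 t = trans (sym (lincomb-basis a t)) (lc≈0 t)

  independent-tail : ∀ {k N} {v : Fin (suc k) → V R N} → Independent v → Independent (v ∘ suc)
  independent-tail v-ind a lc≈0 i =
    v-ind (0# ∷ a) (λ t → trans (+-cong (zeroˡ _) (lc≈0 t)) (+-identityˡ 0#)) (suc i)

  independent-↑ˡ : ∀ m {k N} (v : Fin (m ℕ.+ k) → V R N) → Independent v → Independent (v ∘ (_↑ˡ k))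
  independent-↑ˡ m {k} v v-ind a lc≈0 i =
    ≡.subst (_≈ 0#) (lookup-++ˡ a 0s i) (v-ind (a ++ 0s) extended≈0 (i ↑ˡ k))
    where
    0s : Fin k → A
    0s _ = 0#
    extended≈0 : lincomb R (a ++ 0s) v ≈ᵛ 0ᵛ
    extended≈0 t = begin
      lincomb R (a ++ 0s) v t
        ≈⟨ lincomb-splitAt m (a ++ 0s) v t ⟩
      lincomb R ((a ++ 0s) ∘ (_↑ˡ k)) (v ∘ (_↑ˡ k)) t + lincomb R ((a ++ 0s) ∘ (m ↑ʳ_)) (v ∘ (m ↑ʳ_)) t
        ≈⟨ +-cong (lincomb-congˡ (v ∘ (_↑ˡ k)) (λ i → reflexive (lookup-++ˡ a 0s i)) t)
                  (lincomb-zeroˡ (v ∘ (m ↑ʳ_)) (λ j → reflexive (lookup-++ʳ a 0s j)) t) ⟩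
      lincomb R a (v ∘ (_↑ˡ k)) t + 0#
        ≈⟨ +-identityʳ _ ⟩
      lincomb R a (v ∘ (_↑ˡ k)) t
        ≈⟨ lc≈0 t ⟩
      0# ∎

  independent⇒≤-rank : ∀ {d m N} {M : Pred (V R N) (c ⊔ ℓ)} → HasRank R M m →
                       (u : Fin d → V R N) → (∀ i → M (u i)) → Independent u → d ≤ m
  independent⇒≤-rank {d} {m} rank u Mu u-ind with d ≤? m
  ... | yes d≤m = d≤m
  ... | no d≰m with ℕₚ.m≤n⇒∃[o]m+o≡n (ℕₚ.≰⇒> d≰m)
  ... | e , ≡.refl = ⊥-elim (proj₂ rank (u ∘ (_↑ˡ e)) (Mu ∘ (_↑ˡ e))
                       (independent⇒independentMod-zero {v = u ∘ (_↑ˡ e)} (independent-↑ˡ (suc m) u u-ind)))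

  independent-++ : ∀ {m k N} {S : Pred (V R N) (c ⊔ ℓ)} → IsSubmodule R (vecOps R N) S →
                   {s : Fin m → V R N} {q : Fin k → V R N} →
                   (∀ i → S (s i)) → Independent s → IndependentMod R S q → Independent (s ++ q)
  independent-++ {m} {k} subS@(S-cong , _ , _ , S·) {s} {q} Ss s-ind q-ind a lc≈0 =
    ↑ˡ-↑ʳ-elim m k (λ i → a i ≈ 0#) aˡ≈0 aʳ≈0
    where
    aˡ : Fin m → A
    aˡ = a ∘ (_↑ˡ k)
    aʳ : Fin k → A
    aʳ = a ∘ (m ↑ʳ_)
    halves : ∀ t → lincomb R aˡ s t + lincomb R aʳ q t ≈ 0#
    halves t = trans (sym (lincomb-++ a s q t)) (lc≈0 t)
    aʳ≈0 : ∀ j → aʳ j ≈ 0#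
    aʳ≈0 = q-ind aʳ (S-cong (λ t → sym (x+y≈0⇒y≈-1*x (halves t))) (S· (- 1#) (lincomb-closed subS aˡ s Ss)))
    aˡ≈0 : ∀ i → aˡ i ≈ 0#
    aˡ≈0 = s-ind aˡ (λ t → trans (sym (+-identityʳ _)) (trans (+-congˡ (sym (lincomb-zeroˡ q aʳ≈0 t))) (halves t)))

  -- Gaussian elimination

  module Elimination (dom : IsIntegralDomain R) (_≟ᴿ_ : Decidable _≈_) where

    no-zero-divisorsʳ : ∀ {x y} → x * y ≈ 0# → ¬ y ≈ 0# → x ≈ 0#
    no-zero-divisorsʳ {x} {y} xy≈0 y≉0 with proj₂ dom x y xy≈0
    ... | inj₁ x≈0 = x≈0
    ... | inj₂ y≈0 = ⊥-elim (y≉0 y≈0)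

    no-zero-divisorsˡ : ∀ {x y} → x * y ≈ 0# → ¬ x ≈ 0# → y ≈ 0#
    no-zero-divisorsˡ {x} {y} xy≈0 = no-zero-divisorsʳ (trans (*-comm y x) xy≈0)

    nonzero-coordinate : ∀ {N} (x : V R N) → ¬ x ≈ᵛ 0ᵛ → Σ (Fin N) λ l → ¬ x l ≈ 0#
    nonzero-coordinate x x≉0 = ¬∀⟶∃¬ _ (λ l → x l ≈ 0#) (λ l → x l ≟ᴿ 0#) x≉0

    independent⇒≉0 : ∀ {k N} {u : Fin k → V R N} → Independent u → ∀ i → ¬ u i ≈ᵛ 0ᵛ
    independent⇒≉0 {u = u} u-ind i uᵢ≈0 =
      proj₁ dom (trans (reflexive (≡.sym (basis-diagonal i))) (u-ind (basis i) basisᵢ-coefficients≈0 i))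
      where
      basisᵢ-coefficients≈0 : lincomb R (basis i) u ≈ᵛ 0ᵛ
      basisᵢ-coefficients≈0 t = begin
        lincomb R (basis i) u t          ≈⟨ lincomb-pointwise (basis i) u t ⟩
        sum (λ j → basis i j * u j t)    ≈⟨ sum-cong-≋ (λ j → trans (*-comm _ _) (*-congˡ (reflexive (basis-sym i j)))) ⟩
        sum (λ j → u j t * basis j i)    ≈⟨ sum-*basis (λ j → u j t) i ⟩
        u i t                            ≈⟨ uᵢ≈0 t ⟩
        0#                               ∎

    pivot-independent : ∀ {d N} {u : Fin (suc d) → V R N} → Independent u →
                        (p : Fin (suc d)) {κ : A} → ¬ κ ≈ 0# → (g : Fin d → A) →
                        Independent (λ j → κ ·ᵛ u (punchIn p j) +ᵛ g j ·ᵛ u p)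
    pivot-independent {u = u} u-ind p {κ} κ≉0 g a lc≈0 j =
      no-zero-divisorsʳ (≡.subst (_≈ 0#) (insertAt-punchIn aκ p β₀ j) (u-ind β lcβ≈0 (punchIn p j))) κ≉0
      where
      aκ : Fin _ → A
      aκ j = a j * κ
      β₀ : A
      β₀ = sum (λ j → a j * g j)
      β : Fin (suc _) → A
      β = insertAt aκ p β₀
      lcβ≈0 : lincomb R β u ≈ᵛ 0ᵛ
      lcβ≈0 t = begin
        lincomb R β u t
          ≈⟨ lincomb-pointwise β u t ⟩
        sum (λ i → β i * u i t)
          ≈⟨ sum-remove {i = p} (λ i → β i * u i t) ⟩
        β p * u p t + sum (λ j → β (punchIn p j) * u (punchIn p j) t)
          ≈⟨ +-cong (*-congʳ (reflexive (insertAt-lookup aκ p β₀)))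
                    (sum-cong-≋ (λ j → *-congʳ (reflexive (insertAt-punchIn aκ p β₀ j)))) ⟩
        β₀ * u p t + sum (λ j → aκ j * u (punchIn p j) t)
          ≈⟨ +-comm _ _ ⟩
        sum (λ j → aκ j * u (punchIn p j) t) + β₀ * u p t
          ≈⟨ +-congˡ (*-distribʳ-sum (u p t) (λ j → a j * g j)) ⟩
        sum (λ j → aκ j * u (punchIn p j) t) + sum (λ j → (a j * g j) * u p t)
          ≈⟨ sym (∑-distrib-+ (λ j → aκ j * u (punchIn p j) t) (λ j → (a j * g j) * u p t)) ⟩
        sum (λ j → aκ j * u (punchIn p j) t + (a j * g j) * u p t)
          ≈⟨ sum-cong-≋ (λ j → factor (a j) κ (u (punchIn p j) t) (g j) (u p t)) ⟩
        sum (λ j → a j * (κ * u (punchIn p j) t + g j * u p t))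
          ≈⟨ sym (lincomb-pointwise a _ t) ⟩
        lincomb R a (λ j → κ ·ᵛ u (punchIn p j) +ᵛ g j ·ᵛ u p) t
          ≈⟨ lc≈0 t ⟩
        0# ∎
        where
        factor : ∀ a b x y z → (a * b) * x + (a * y) * z ≈ a * (b * x + y * z)
        factor = solve 5 (λ a b x y z → (a :* b) :* x :+ (a :* y) :* z := a :* (b :* x :+ y :* z)) refl

    -- Induction on k: pivoting the d + 1 vectors annihilating the last k vectors on
    -- one that a₀ does not annihilate yields d vectors annihilating a₀ as well.
    independent-annihilator : ∀ {N} k d → k ℕ.+ d ≡ N → (a : Fin k → V R N) →
                              Σ (Fin d → V R N) λ u → Independent u × (∀ i j → dot (a i) (u j) ≈ 0#)
    independent-annihilator zero d ≡.refl a = basis , basis-independent , λ ()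
    independent-annihilator (suc k) d k+d≡N a
      with independent-annihilator k (suc d) (≡.trans (ℕₚ.+-suc k d) k+d≡N) (a ∘ suc)
    ... | u , u-ind , a⊥u with all? (λ j → dot (a zero) (u j) ≟ᴿ 0#)
    ... | yes a₀⊥u = u ∘ suc , independent-tail {v = u} u-ind , λ { zero j → a₀⊥u (suc j) ; (suc i) j → a⊥u i (suc j) }
    ... | no ¬a₀⊥u with ¬∀⟶∃¬ _ _ (λ j → dot (a zero) (u j) ≟ᴿ 0#) ¬a₀⊥u
    ... | p , κ≉0 = w , pivot-independent {u = u} u-ind p κ≉0 g , a⊥w
      where
      κ : A
      κ = dot (a zero) (u p)
      g : Fin d → A
      g j = - dot (a zero) (u (punchIn p j))
      w : Fin d → V R _
      w j = κ ·ᵛ u (punchIn p j) +ᵛ g j ·ᵛ u p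
      a⊥w : ∀ i j → dot (a i) (w j) ≈ 0#
      a⊥w zero    j = trans (dot-linearʳ (a zero) (u (punchIn p j)) (u p) κ (g j))
                            (x*y+-y*x≈0 κ (dot (a zero) (u (punchIn p j))))
      a⊥w (suc i) j = trans (dot-linearʳ (a (suc i)) (u (punchIn p j)) (u p) κ (g j))
                            (trans (+-cong (trans (*-congˡ (a⊥u i (punchIn p j))) (zeroʳ κ))
                                           (trans (*-congˡ (a⊥u i p)) (zeroʳ (g j))))
                                   (+-identityˡ 0#))

    -- When p > N, the N coordinate rows of b have a nonzero common annihilator in Rᵖ,
    -- which is a linear dependence among the bⱼ.
    independent⇒≤ : ∀ {p N} (b : Fin p → V R N) → Independent b → p ≤ N
    independent⇒≤ {p} {N} b b-ind with p ≤? N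
    ... | yes p≤N = p≤N
    ... | no p≰N with ℕₚ.m≤n⇒∃[o]m+o≡n (ℕₚ.≰⇒> p≰N)
    ... | e , ≡.refl = ⊥-elim (independent⇒≉0 {u = u} (proj₁ (proj₂ annihilator)) zero (b-ind (u zero) dependence))
      where
      annihilator : Σ (Fin (suc e) → V R p) λ u → Independent u × (∀ l j → dot (λ i → b i l) (u j) ≈ 0#)
      annihilator = independent-annihilator N (suc e) (ℕₚ.+-suc N e) (λ l i → b i l)
      u : Fin (suc e) → V R p
      u = proj₁ annihilator
      dependence : lincomb R (u zero) b ≈ᵛ 0ᵛ
      dependence l = trans (lincomb-pointwise (u zero) b l)
        (trans (sum-cong-≋ (λ j → *-comm (u zero j) (b j l))) (proj₂ (proj₂ annihilator) l zero))

    independent-punchIn : ∀ {k N} {v : Fin k → V R (suc N)} → Independent v → (l : Fin (suc N)) →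
                          (∀ i → v i l ≈ 0#) → Independent (λ i → v i ∘ punchIn l)
    independent-punchIn {v = v} v-ind l vₗ≈0 a lc≈0 =
      v-ind a (≈ᵛ-punchIn (lincomb R a v) 0ᵛ l lcₗ≈0 (λ t → trans (sym (lincomb-reindex a v (punchIn l) t)) (lc≈0 t)))
      where
      lcₗ≈0 : lincomb R a v l ≈ 0#
      lcₗ≈0 = trans (lincomb-pointwise a v l) (sum-zero _ (λ i → trans (*-congˡ (vₗ≈0 i)) (zeroʳ (a i))))

    ⊥-independent-punchIn : ∀ {p N} (x : V R (suc N)) l → ¬ x l ≈ 0# → {b : Fin p → V R (suc N)} →
                            Independent b → (∀ j → dot x (b j) ≈ 0#) → Independent (λ j → b j ∘ punchIn l)
    ⊥-independent-punchIn x l xₗ≉0 {b} b-ind x⊥b a lc≈0 =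
      b-ind a (≈ᵛ-punchIn y 0ᵛ l (no-zero-divisorsˡ xₗyₗ≈0 xₗ≉0) y∘punchIn≈0)
      where
      y : V R _
      y = lincomb R a b
      y∘punchIn≈0 : (y ∘ punchIn l) ≈ᵛ 0ᵛ
      y∘punchIn≈0 t = trans (sym (lincomb-reindex a b (punchIn l) t)) (lc≈0 t)
      xₗyₗ≈0 : x l * y l ≈ 0#
      xₗyₗ≈0 = begin
        x l * y l                                        ≈⟨ sym (+-identityʳ _) ⟩
        x l * y l + 0#                                   ≈⟨ +-congˡ (sym (dot-zeroʳ (x ∘ punchIn l) (y ∘ punchIn l) y∘punchIn≈0)) ⟩
        x l * y l + dot (x ∘ punchIn l) (y ∘ punchIn l)  ≈⟨ sym (dot-punchIn x y l) ⟩
        dot x y                                          ≈⟨ dot-lincombʳ x a b ⟩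
        sum (λ j → a j * dot x (b j))                    ≈⟨ sum-zero _ (λ j → trans (*-congˡ (x⊥b j)) (zeroʳ (a j))) ⟩
        0#                                               ∎

    -- Pivoting on a nonzero coordinate l of a₀ clears coordinate l from the other aᵢ;
    -- deleting that coordinate keeps both families independent and orthogonal.
    orthogonal-independent⇒≤ : ∀ {k p N} (a : Fin k → V R N) (b : Fin p → V R N) →
                               Independent a → Independent b → (∀ i j → dot (a i) (b j) ≈ 0#) → k ℕ.+ p ≤ N
    orthogonal-independent⇒≤ {zero} a b a-ind b-ind a⊥b = independent⇒≤ b b-ind
    orthogonal-independent⇒≤ {suc k} {N = zero} a b a-ind b-ind a⊥b
      with nonzero-coordinate (a zero) (independent⇒≉0 {u = a} a-ind zero)
    ... | () , _
    orthogonal-independent⇒≤ {suc k} {N = suc N} a b a-ind b-ind a⊥b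
      with nonzero-coordinate (a zero) (independent⇒≉0 {u = a} a-ind zero)
    ... | l , κ≉0 = s≤s (orthogonal-independent⇒≤ (λ i → a′ i ∘ punchIn l) (λ j → b j ∘ punchIn l)
                          (independent-punchIn {v = a′} (pivot-independent {u = a} a-ind zero κ≉0 g) l a′ₗ≈0)
                          (⊥-independent-punchIn (a zero) l κ≉0 b-ind (a⊥b zero))
                          a′⊥b′)
      where
      κ : A
      κ = a zero l
      g : Fin k → A
      g i = - a (suc i) l
      a′ : Fin k → V R (suc N)
      a′ i = κ ·ᵛ a (suc i) +ᵛ g i ·ᵛ a zero
      a′ₗ≈0 : ∀ i → a′ i l ≈ 0#
      a′ₗ≈0 i = x*y+-y*x≈0 κ (a (suc i) l)
      a′⊥b′ : ∀ i j → dot (a′ i ∘ punchIn l) (b j ∘ punchIn l) ≈ 0#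
      a′⊥b′ i j = begin
        dot (a′ i ∘ punchIn l) (b j ∘ punchIn l)                   ≈⟨ sym (+-identityˡ _) ⟩
        0# + dot (a′ i ∘ punchIn l) (b j ∘ punchIn l)              ≈⟨ +-congʳ (sym (trans (*-congʳ (a′ₗ≈0 i)) (zeroˡ _))) ⟩
        a′ i l * b j l + dot (a′ i ∘ punchIn l) (b j ∘ punchIn l)  ≈⟨ sym (dot-punchIn (a′ i) (b j) l) ⟩
        dot (a′ i) (b j)                                           ≈⟨ dot-linearˡ (b j) (a (suc i)) (a zero) κ (g i) ⟩
        κ * dot (a (suc i)) (b j) + g i * dot (a zero) (b j)       ≈⟨ +-cong (*-congˡ (a⊥b (suc i) j)) (*-congˡ (a⊥b zero j)) ⟩
        κ * 0# + g i * 0#                                          ≈⟨ +-cong (zeroʳ κ) (zeroʳ (g i)) ⟩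
        0# + 0#                                                    ≈⟨ +-identityˡ 0# ⟩
        0#                                                         ∎

  -- Alternating bilinear forms

  module AlternatingForm {W : Set c} (ops : LinOps R W) {B : W → W → A} (alt : IsAltBilinear R ops B) where
    open LinOps ops

    B-cong : ∀ {x x′ y y′} → x ≈W x′ → y ≈W y′ → B x y ≈ B x′ y′
    B-cong = proj₁ alt

    B-+ˡ : ∀ x x′ y → B (x +W x′) y ≈ B x y + B x′ y
    B-+ˡ = proj₁ (proj₂ alt)

    B-·ˡ : ∀ a x y → B (a ·W x) y ≈ a * B x y
    B-·ˡ = proj₁ (proj₂ (proj₂ alt))

    B-+ʳ : ∀ x y y′ → B x (y +W y′) ≈ B x y + B x y′
    B-+ʳ = proj₁ (proj₂ (proj₂ (proj₂ alt)))

    B-·ʳ : ∀ a x y → B x (a ·W y) ≈ a * B x y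
    B-·ʳ = proj₁ (proj₂ (proj₂ (proj₂ (proj₂ alt))))

    B-alternating : ∀ x → B x x ≈ 0#
    B-alternating = proj₂ (proj₂ (proj₂ (proj₂ (proj₂ alt))))

    B-skew : ∀ x y → B x y + B y x ≈ 0#
    B-skew x y = begin
      B x y + B y x                      ≈⟨ +-cong (sym (+-identityˡ _)) (sym (+-identityʳ _)) ⟩
      (0# + B x y) + (B y x + 0#)        ≈⟨ +-cong (+-congʳ (sym (B-alternating x))) (+-congˡ (sym (B-alternating y))) ⟩
      (B x x + B x y) + (B y x + B y y)  ≈⟨ +-cong (sym (B-+ʳ x x y)) (sym (B-+ʳ y x y)) ⟩
      B x (x +W y) + B y (x +W y)        ≈⟨ sym (B-+ˡ x y (x +W y)) ⟩
      B (x +W y) (x +W y)                ≈⟨ B-alternating _ ⟩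
      0#                                 ∎

    B-⊥-sym : ∀ {x y} → B x y ≈ 0# → B y x ≈ 0#
    B-⊥-sym {x} {y} Bxy≈0 = trans (sym (+-identityˡ _)) (trans (+-congʳ (sym Bxy≈0)) (B-skew x y))

    B-expand : ∀ x y z a b → B (x +W (a ·W z)) (y +W (b ·W z)) ≈ B x y + (b * B x z + (a * B z y + a * (b * B z z)))
    B-expand x y z a b = begin
      B (x +W (a ·W z)) (y +W (b ·W z))                      ≈⟨ B-+ˡ _ _ _ ⟩
      B x (y +W (b ·W z)) + B (a ·W z) (y +W (b ·W z))       ≈⟨ +-cong (B-+ʳ _ _ _) (B-·ˡ _ _ _) ⟩
      (B x y + B x (b ·W z)) + a * B z (y +W (b ·W z))     ≈⟨ +-cong (+-congˡ (B-·ʳ _ _ _)) (*-congˡ (B-+ʳ _ _ _)) ⟩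
      (B x y + b * B x z) + a * (B z y + B z (b ·W z))   ≈⟨ +-congˡ (*-congˡ (+-congˡ (B-·ʳ _ _ _))) ⟩
      (B x y + b * B x z) + a * (B z y + b * B z z)      ≈⟨ reassociate _ _ _ _ _ _ ⟩
      B x y + (b * B x z + (a * B z y + a * (b * B z z))) ∎
      where
      reassociate : ∀ p q r s a b → (p + b * q) + a * (r + b * s) ≈ p + (b * q + (a * r + a * (b * s)))
      reassociate = solve 6 (λ p q r s a b → (p :+ b :* q) :+ a :* (r :+ b :* s) := p :+ (b :* q :+ (a :* r :+ a :* (b :* s)))) refl

  module VectorForm {N} {B : V R N → V R N → A} (alt : IsAltBilinear R (vecOps R N) B) where
    open AlternatingForm (vecOps R N) alt public

    B-0ˡ : ∀ y → B 0ᵛ y ≈ 0#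
    B-0ˡ y = trans (B-cong {x′ = 0# ·ᵛ 0ᵛ} {y′ = y} (λ _ → sym (zeroˡ 0#)) (λ _ → refl)) (trans (B-·ˡ 0# 0ᵛ y) (zeroˡ _))

    B-0ʳ : ∀ x → B x 0ᵛ ≈ 0#
    B-0ʳ x = trans (B-cong {x′ = x} {y′ = 0# ·ᵛ 0ᵛ} (λ _ → refl) (λ _ → sym (zeroˡ 0#))) (trans (B-·ʳ 0# x 0ᵛ) (zeroˡ _))

    B-lincombˡ : ∀ {k} (a : Fin k → A) (v : Fin k → V R N) y → B (lincomb R a v) y ≈ sum (λ j → a j * B (v j) y)
    B-lincombˡ {zero}  a v y = B-0ˡ y
    B-lincombˡ {suc k} a v y = trans (B-+ˡ _ _ y) (+-cong (B-·ˡ (a zero) (v zero) y) (B-lincombˡ (a ∘ suc) (v ∘ suc) y))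

    B-lincombʳ : ∀ {k} x (a : Fin k → A) (v : Fin k → V R N) → B x (lincomb R a v) ≈ sum (λ j → a j * B x (v j))
    B-lincombʳ {zero}  x a v = B-0ʳ x
    B-lincombʳ {suc k} x a v = trans (B-+ʳ x _ _) (+-cong (B-·ʳ (a zero) x (v zero)) (B-lincombʳ x (a ∘ suc) (v ∘ suc)))

    B-lincomb-∷ˡ : ∀ {k} (a : Fin (suc k) → A) x (v : Fin k → V R N) y →
                   (∀ j → B (v j) y ≈ 0#) → B (lincomb R a (x ∷ v)) y ≈ a zero * B x y
    B-lincomb-∷ˡ a x v y v⊥y = begin
      B (lincomb R a (x ∷ v)) y                            ≈⟨ B-lincombˡ a (x ∷ v) y ⟩
      a zero * B x y + sum (λ j → a (suc j) * B (v j) y)   ≈⟨ +-congˡ (sum-zero _ (λ j → trans (*-congˡ (v⊥y j)) (zeroʳ _))) ⟩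
      a zero * B x y + 0#                                  ≈⟨ +-identityʳ _ ⟩
      a zero * B x y                                       ∎

    dot-column : ∀ x y → dot x (λ l → B (basis l) y) ≈ B x y
    dot-column x y = begin
      sum (λ l → x l * B (basis l) y)   ≈⟨ sym (B-lincombˡ x basis y) ⟩
      B (lincomb R x basis) y           ≈⟨ B-cong (lincomb-basis x) (λ _ → refl) ⟩
      B x y                             ∎

    dot-row : ∀ x y → dot (λ l → B x (basis l)) y ≈ B x y
    dot-row x y = begin
      sum (λ l → B x (basis l) * y l)   ≈⟨ sum-cong-≋ (λ l → *-comm (B x (basis l)) (y l)) ⟩
      sum (λ l → y l * B x (basis l))   ≈⟨ sym (B-lincombʳ x y basis) ⟩
      B x (lincomb R y basis)           ≈⟨ B-cong (λ _ → refl) (lincomb-basis y) ⟩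
      B x y                             ∎

    nondegenerate⇒columns-independent : NonDegenerate R (vecOps R N) B → ∀ {k} {w : Fin k → V R N} →
      Independent w → Independent (λ j l → B (basis l) (w j))
    nondegenerate⇒columns-independent nd {w = w} w-ind a lc≈0 = w-ind a (nd y (λ x → B-⊥-sym (x⊥y x)))
      where
      y : V R N
      y = lincomb R a w
      x⊥y : ∀ x → B x y ≈ 0#
      x⊥y x = trans (sym (dot-column x y)) (dot-zeroʳ x _ (λ l →
        trans (B-lincombʳ (basis l) a w) (trans (sym (lincomb-pointwise a _ l)) (lc≈0 l))))

    rad-isSubmodule : ∀ {S : Pred (V R N) (c ⊔ ℓ)} → IsSubmodule R (vecOps R N) S → IsSubmodule R (vecOps R N) (rad R B S)
    rad-isSubmodule (S-cong , S0 , S+ , S·) =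
      (λ x≈y (Sx , x⊥S) → S-cong x≈y Sx , λ z Sz → trans (B-cong (λ t → sym (x≈y t)) (λ _ → refl)) (x⊥S z Sz)) ,
      (S0 , λ z _ → B-0ˡ z) ,
      (λ (Sx , x⊥S) (Sy , y⊥S) → S+ Sx Sy , λ z Sz →
        trans (B-+ˡ _ _ z) (trans (+-cong (x⊥S z Sz) (y⊥S z Sz)) (+-identityˡ 0#))) ,
      (λ a (Sx , x⊥S) → S· a Sx , λ z Sz → trans (B-·ˡ a _ z) (trans (*-congˡ (x⊥S z Sz)) (zeroʳ a)))

  module Classical (lem : (P : Set (c ⊔ ℓ)) → Dec P) where

    _≟ᴿ_ : Decidable _≈_
    x ≟ᴿ y = map′ lower lift (lem (Lift c (x ≈ y)))

    ¬∀⇒∃¬ : {I : Set c} {P : I → Set (c ⊔ ℓ)} → ¬ (∀ i → P i) → Σ I (λ i → ¬ P i)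
    ¬∀⇒∃¬ {I} {P} ¬∀P with lem (Σ I (λ i → ¬ P i))
    ... | yes ∃¬P = ∃¬P
    ... | no ¬∃¬P = ⊥-elim (¬∀P (λ i → decidable-stable (lem (P i)) (λ ¬Pi → ¬∃¬P (i , ¬Pi))))

    dependence-on-head : ∀ {k N} {S : Pred (V R N) (c ⊔ ℓ)} → (∀ {x y} → x ≈ᵛ y → S x → S y) →
                         {x : V R N} {v : Fin k → V R N} → IndependentMod R S v → ¬ IndependentMod R S (x ∷ v) →
                         Σ (Fin (suc k) → A) λ a → S (lincomb R a (x ∷ v)) × ¬ a zero ≈ 0#
    dependence-on-head {S = S} S-cong {x} {v} v-ind ¬x∷v-ind with ¬∀⇒∃¬ ¬x∷v-ind
    ... | a , ¬[Sa⇒a≈0] with lem (S (lincomb R a (x ∷ v)))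
    ... | no ¬Sa = ⊥-elim (¬[Sa⇒a≈0] (⊥-elim ∘ ¬Sa))
    ... | yes Sa = a , Sa , λ a₀≈0 → ¬[Sa⇒a≈0] (λ _ → λ
                     { zero    → a₀≈0
                     ; (suc i) → v-ind (a ∘ suc) (S-cong (drop-head a₀≈0) Sa) i })
      where
      drop-head : a zero ≈ 0# → lincomb R a (x ∷ v) ≈ᵛ lincomb R (a ∘ suc) v
      drop-head a₀≈0 t = trans (+-congʳ (trans (*-congʳ a₀≈0) (zeroˡ (x t)))) (+-identityˡ _)

  -- Coisotropic submodules

  module Coisotropic (lem : (P : Set (c ⊔ ℓ)) → Dec P) (dom : IsIntegralDomain R) {N} {B : V R N → V R N → A}
                     (alt : IsAltBilinear R (vecOps R N) B) (nd : NonDegenerate R (vecOps R N) B)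
                     {W : Pred (V R N) (c ⊔ ℓ)} (W-sub : IsSubmodule R (vecOps R N) W)
                     (W-coisotropic : ∀ y → (∀ x → W x → B x y ≈ 0#) → W y)
                     {m₁ k : ℕ} (rank-quotient : HasRankMod R W (rad R B W) k)
                     (rank-rad : HasRank R (rad R B W) m₁) where
    open Classical lem
    open Elimination dom _≟ᴿ_
    open VectorForm alt

    s : Fin m₁ → V R N
    s = proj₁ (proj₁ rank-rad)

    s-rad : ∀ i → rad R B W (s i)
    s-rad = proj₁ (proj₂ (proj₁ rank-rad))

    s-independent : Independent s
    s-independent = independentMod-zero⇒independent (proj₂ (proj₂ (proj₁ rank-rad)))

    q : Fin k → V R N
    q = proj₁ (proj₁ rank-quotient)

    q-W : ∀ j → W (q j)
    q-W = proj₁ (proj₂ (proj₁ rank-quotient))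

    q-independent : IndependentMod R (rad R B W) q
    q-independent = proj₂ (proj₂ (proj₁ rank-quotient))

    w : Fin (m₁ ℕ.+ k) → V R N
    w = s ++ q

    w-W : ∀ i → W (w i)
    w-W = ↑ˡ-↑ʳ-elim m₁ k (W ∘ w)
      (λ i → ≡.subst W (≡.sym (lookup-++ˡ s q i)) (proj₁ (s-rad i)))
      (λ j → ≡.subst W (≡.sym (lookup-++ʳ s q j)) (q-W j))

    w-independent : Independent w
    w-independent = independent-++ (rad-isSubmodule W-sub) s-rad s-independent q-independent

    -- x depends on q modulo rad W with a nonzero coefficient a₀ on x, and the resulting
    -- z ∈ rad W depends on s with a nonzero coefficient b₀ on z; as y ⊥ s, q this gives
    -- b₀ (a₀ B x y) ≈ 0.
    ⊥w⇒⊥W : ∀ y → (∀ i → B (w i) y ≈ 0#) → ∀ x → W x → B x y ≈ 0#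
    ⊥w⇒⊥W y w⊥y x Wx = no-zero-divisorsˡ a₀Bxy≈0 a₀≉0
      where
      s⊥y : ∀ i → B (s i) y ≈ 0#
      s⊥y i = ≡.subst (λ v → B v y ≈ 0#) (lookup-++ˡ s q i) (w⊥y (i ↑ˡ k))
      q⊥y : ∀ j → B (q j) y ≈ 0#
      q⊥y j = ≡.subst (λ v → B v y ≈ 0#) (lookup-++ʳ s q j) (w⊥y (m₁ ↑ʳ j))
      x-dependence : Σ (Fin (suc k) → A) λ a → rad R B W (lincomb R a (x ∷ q)) × ¬ a zero ≈ 0#
      x-dependence = dependence-on-head (proj₁ (rad-isSubmodule W-sub)) q-independent
                       (proj₂ rank-quotient (x ∷ q) (λ { zero → Wx ; (suc j) → q-W j }))
      a : Fin (suc k) → A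
      a = proj₁ x-dependence
      a₀≉0 : ¬ a zero ≈ 0#
      a₀≉0 = proj₂ (proj₂ x-dependence)
      z : V R N
      z = lincomb R a (x ∷ q)
      z-dependence : Σ (Fin (suc m₁) → A) λ b → zeroSub R (lincomb R b (z ∷ s)) × ¬ b zero ≈ 0#
      z-dependence = dependence-on-head (λ x≈y x≈0 → lift (λ t → trans (sym (x≈y t)) (lower x≈0 t)))
                       (proj₂ (proj₂ (proj₁ rank-rad)))
                       (proj₂ rank-rad (z ∷ s) (λ { zero → proj₁ (proj₂ x-dependence) ; (suc i) → s-rad i }))
      b : Fin (suc m₁) → A
      b = proj₁ z-dependence
      b₀Bzy≈0 : b zero * B z y ≈ 0#
      b₀Bzy≈0 = trans (sym (B-lincomb-∷ˡ b z s y s⊥y))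
                      (trans (B-cong (lower (proj₁ (proj₂ z-dependence))) (λ _ → refl)) (B-0ˡ y))
      a₀Bxy≈0 : a zero * B x y ≈ 0#
      a₀Bxy≈0 = trans (sym (B-lincomb-∷ˡ a x q y q⊥y)) (no-zero-divisorsˡ b₀Bzy≈0 (proj₂ (proj₂ z-dependence)))

    ⊥w⇒rad : ∀ y → (∀ i → B (w i) y ≈ 0#) → rad R B W y
    ⊥w⇒rad y w⊥y = W-coisotropic y (⊥w⇒⊥W y w⊥y) , λ x Wx → B-⊥-sym (⊥w⇒⊥W y w⊥y x Wx)

    2m₁+k≤N : m₁ ℕ.+ (m₁ ℕ.+ k) ≤ N
    2m₁+k≤N = orthogonal-independent⇒≤ s (λ j l → B (basis l) (w j)) s-independent
      (nondegenerate⇒columns-independent nd w-independent)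
      (λ i j → trans (dot-column (s i) (w j)) (proj₂ (s-rad i) (w j) (w-W j)))

    N≤2m₁+k : N ≤ m₁ ℕ.+ (m₁ ℕ.+ k)
    N≤2m₁+k with ℕₚ.m≤n⇒∃[o]m+o≡n (ℕₚ.≤-trans (ℕₚ.m≤n+m (m₁ ℕ.+ k) m₁) 2m₁+k≤N)
    ... | d , m₁+k+d≡N = ℕₚ.≤-trans (ℕₚ.≤-reflexive (≡.sym m₁+k+d≡N))
                           (ℕₚ.≤-trans (ℕₚ.+-monoʳ-≤ (m₁ ℕ.+ k) d≤m₁) (ℕₚ.≤-reflexive (ℕₚ.+-comm (m₁ ℕ.+ k) m₁)))
      where
      annihilator : Σ (Fin d → V R N) λ u → Independent u × (∀ i j → dot (B (w i) ∘ basis) (u j) ≈ 0#)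
      annihilator = independent-annihilator (m₁ ℕ.+ k) d m₁+k+d≡N (λ i → B (w i) ∘ basis)
      u : Fin d → V R N
      u = proj₁ annihilator
      w⊥u : ∀ i j → B (w i) (u j) ≈ 0#
      w⊥u i j = trans (sym (dot-row (w i) (u j))) (proj₂ (proj₂ annihilator) i j)
      d≤m₁ : d ≤ m₁
      d≤m₁ = independent⇒≤-rank {M = rad R B W} rank-rad u (λ j → ⊥w⇒rad (u j) (λ i → w⊥u i j)) (proj₁ (proj₂ annihilator))

    coisotropic-rank : m₁ ℕ.+ (m₁ ℕ.+ k) ≡ N
    coisotropic-rank = ℕₚ.≤-antisym 2m₁+k≤N N≤2m₁+k

  -- Maximal totally isotropic submodules of an orthogonal sum

  orthSum-isAltBilinear : ∀ {p q} {B₁ : V R p → V R p → A} {B₂ : V R q → V R q → A} →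
                          IsAltBilinear R (vecOps R p) B₁ → IsAltBilinear R (vecOps R q) B₂ →
                          IsAltBilinear R (pairOps R p q) (orthSum R B₁ B₂)
  orthSum-isAltBilinear {p} {q} alt₁ alt₂ =
    (λ (x₁≈x₁′ , x₂≈x₂′) (y₁≈y₁′ , y₂≈y₂′) → +-cong (F₁.B-cong x₁≈x₁′ y₁≈y₁′) (F₂.B-cong x₂≈x₂′ y₂≈y₂′)) ,
    (λ x x′ y → trans (+-cong (F₁.B-+ˡ _ _ _) (F₂.B-+ˡ _ _ _)) (interchange _ _ _ _)) ,
    (λ a x y → trans (+-cong (F₁.B-·ˡ a _ _) (F₂.B-·ˡ a _ _)) (sym (distribˡ a _ _))) ,
    (λ x y y′ → trans (+-cong (F₁.B-+ʳ _ _ _) (F₂.B-+ʳ _ _ _)) (interchange _ _ _ _)) ,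
    (λ a x y → trans (+-cong (F₁.B-·ʳ a _ _) (F₂.B-·ʳ a _ _)) (sym (distribˡ a _ _))) ,
    (λ x → trans (+-cong (F₁.B-alternating _) (F₂.B-alternating _)) (+-identityˡ 0#))
    where
    module F₁ = AlternatingForm (vecOps R p) alt₁
    module F₂ = AlternatingForm (vecOps R q) alt₂

  module MaximalIsotropic {p q} {B : V₂ R p q → V₂ R p q → A} (alt : IsAltBilinear R (pairOps R p q) B)
                          {X : Pred (V₂ R p q) (c ⊔ ℓ)} (X-max : MaximalTotallyIsotropic R (pairOps R p q) B X) where
    open AlternatingForm (pairOps R p q) alt
    open LinOps (pairOps R p q)

    -- X + R y is totally isotropic (y is isotropic as B is alternating), hence equal to X.
    ⊥⇒∈ : ∀ y → (∀ x → X x → B x y ≈ 0#) → X y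
    ⊥⇒∈ y X⊥y = proj₂ (proj₂ X-max) Y Y-sub Y-isotropic X⊆Y y∈Y
      where
      X-sub : IsSubmodule R (pairOps R p q) X
      X-sub = proj₁ X-max
      Y : Pred (V₂ R p q) (c ⊔ ℓ)
      Y z = Σ (V₂ R p q) λ x → Σ A λ a → X x × z ≈W (x +W (a ·W y))
      Y-sub : IsSubmodule R (pairOps R p q) Y
      Y-sub = Y-cong , (0W , 0# , proj₁ (proj₂ X-sub) , 0≈0+0*y (proj₁ y) , 0≈0+0*y (proj₂ y)) , Y-+ , Y-·
        where
        0≈0+0*y : ∀ {n} (v : V R n) → 0ᵛ ≈ᵛ 0ᵛ +ᵛ 0# ·ᵛ v
        0≈0+0*y v t = sym (trans (+-identityˡ _) (zeroˡ (v t)))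
        Y-cong : ∀ {z z′} → z ≈W z′ → Y z → Y z′
        Y-cong (z₁≈ , z₂≈) (x , a , Xx , e₁ , e₂) = x , a , Xx , (λ t → trans (sym (z₁≈ t)) (e₁ t)) , (λ t → trans (sym (z₂≈ t)) (e₂ t))
        collect : ∀ u u′ a a′ v → (u + a * v) + (u′ + a′ * v) ≈ (u + u′) + (a + a′) * v
        collect = solve 5 (λ u u′ a a′ v → (u :+ a :* v) :+ (u′ :+ a′ :* v) := (u :+ u′) :+ (a :+ a′) :* v) refl
        Y-+ : ∀ {z z′} → Y z → Y z′ → Y (z +W z′)
        Y-+ (x , a , Xx , e₁ , e₂) (x′ , a′ , Xx′ , e₁′ , e₂′) =
          x +W x′ , a + a′ , proj₁ (proj₂ (proj₂ X-sub)) Xx Xx′ ,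
          (λ t → trans (+-cong (e₁ t) (e₁′ t)) (collect _ _ _ _ _)) , (λ t → trans (+-cong (e₂ t) (e₂′ t)) (collect _ _ _ _ _))
        distribute : ∀ b u a v → b * (u + a * v) ≈ b * u + (b * a) * v
        distribute = solve 4 (λ b u a v → b :* (u :+ a :* v) := b :* u :+ (b :* a) :* v) refl
        Y-· : ∀ b {z} → Y z → Y (b ·W z)
        Y-· b (x , a , Xx , e₁ , e₂) =
          b ·W x , b * a , proj₂ (proj₂ (proj₂ X-sub)) b Xx ,
          (λ t → trans (*-congˡ (e₁ t)) (distribute _ _ _ _)) , (λ t → trans (*-congˡ (e₂ t)) (distribute _ _ _ _))
      Y-isotropic : TotallyIsotropic R B Y
      Y-isotropic z z′ (x , a , Xx , e) (x′ , a′ , Xx′ , e′) = begin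
        B z z′                                                              ≈⟨ B-cong e e′ ⟩
        B (x +W (a ·W y)) (x′ +W (a′ ·W y))                                 ≈⟨ B-expand x x′ y a a′ ⟩
        B x x′ + (a′ * B x y + (a * B y x′ + a * (a′ * B y y)))
          ≈⟨ +-cong (proj₁ (proj₂ X-max) x x′ Xx Xx′) (+-cong (*-congˡ (X⊥y x Xx))
               (+-cong (*-congˡ (B-⊥-sym (X⊥y x′ Xx′))) (*-congˡ (*-congˡ (B-alternating y))))) ⟩
        0# + (a′ * 0# + (a * 0# + a * (a′ * 0#)))                          ≈⟨ vanish a a′ ⟩
        0#                                                                  ∎
        where
        vanish : ∀ a a′ → 0# + (a′ * 0# + (a * 0# + a * (a′ * 0#))) ≈ 0#
        vanish = solve 2 (λ a a′ → con 0 :+ (a′ :* con 0 :+ (a :* con 0 :+ a :* (a′ :* con 0))) := con 0) refl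
      X⊆Y : X ⊆ Y
      X⊆Y {x} Xx = x , 0# , Xx , (λ t → sym (trans (+-congˡ (zeroˡ _)) (+-identityʳ _))) ,
                                  (λ t → sym (trans (+-congˡ (zeroˡ _)) (+-identityʳ _)))
      y∈Y : Y y
      y∈Y = 0W , 1# , proj₁ (proj₂ X-sub) ,
            (λ t → sym (trans (+-identityˡ _) (*-identityˡ _))) , (λ t → sym (trans (+-identityˡ _) (*-identityˡ _)))

  module OrthogonalSum {p q} {B₁ : V R p → V R p → A} {B₂ : V R q → V R q → A}
                       (alt₁ : IsAltBilinear R (vecOps R p) B₁) (alt₂ : IsAltBilinear R (vecOps R q) B₂)
                       {X : Pred (V₂ R p q) (c ⊔ ℓ)}
                       (X-max : MaximalTotallyIsotropic R (pairOps R p q) (orthSum R B₁ B₂) X) where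
    open MaximalIsotropic (orthSum-isAltBilinear alt₁ alt₂) X-max
    open LinOps (pairOps R p q)
    module F₁ = VectorForm alt₁
    module F₂ = VectorForm alt₂

    linear-image-isSubmodule : ∀ {n} (π : V₂ R p q → V R n) → π 0W ≈ᵛ 0ᵛ →
      (∀ x y → π (x +W y) ≈ᵛ π x +ᵛ π y) → (∀ a x → π (a ·W x) ≈ᵛ a ·ᵛ π x) →
      IsSubmodule R (vecOps R n) (λ v → Σ (V₂ R p q) λ z → X z × π z ≈ᵛ v)
    linear-image-isSubmodule π π-0 π-+ π-· =
      (λ v≈v′ (z , Xz , πz≈v) → z , Xz , λ t → trans (πz≈v t) (v≈v′ t)) ,
      (0W , proj₁ (proj₂ (proj₁ X-max)) , π-0) ,
      (λ (z , Xz , πz≈v) (z′ , Xz′ , πz′≈v′) →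
        z +W z′ , proj₁ (proj₂ (proj₂ (proj₁ X-max))) Xz Xz′ , λ t → trans (π-+ z z′ t) (+-cong (πz≈v t) (πz′≈v′ t))) ,
      (λ a (z , Xz , πz≈v) →
        a ·W z , proj₂ (proj₂ (proj₂ (proj₁ X-max))) a Xz , λ t → trans (π-· a z t) (*-congˡ (πz≈v t)))

    image₁-isSubmodule : IsSubmodule R (vecOps R p) (image₁ R X)
    image₁-isSubmodule = linear-image-isSubmodule proj₁ (λ _ → refl) (λ _ _ _ → refl) (λ _ _ _ → refl)

    image₂-isSubmodule : IsSubmodule R (vecOps R q) (image₂ R X)
    image₂-isSubmodule = linear-image-isSubmodule proj₂ (λ _ → refl) (λ _ _ _ → refl) (λ _ _ _ → refl)

    image₁-coisotropic : ∀ y → (∀ x → image₁ R X x → B₁ x y ≈ 0#) → image₁ R X y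
    image₁-coisotropic y X₁⊥y = (y , 0ᵛ) , ⊥⇒∈ (y , 0ᵛ) X⊥[y,0] , λ _ → refl
      where
      X⊥[y,0] : ∀ x → X x → orthSum R B₁ B₂ x (y , 0ᵛ) ≈ 0#
      X⊥[y,0] x Xx = trans (+-cong (X₁⊥y (proj₁ x) (x , Xx , λ _ → refl)) (F₂.B-0ʳ (proj₂ x))) (+-identityˡ 0#)

    image₂-coisotropic : ∀ y → (∀ x → image₂ R X x → B₂ x y ≈ 0#) → image₂ R X y
    image₂-coisotropic y X₂⊥y = (0ᵛ , y) , ⊥⇒∈ (0ᵛ , y) X⊥[0,y] , λ _ → refl
      where
      X⊥[0,y] : ∀ x → X x → orthSum R B₁ B₂ x (0ᵛ , y) ≈ 0#
      X⊥[0,y] x Xx = trans (+-cong (F₁.B-0ʳ (proj₁ x)) (X₂⊥y (proj₂ x) (x , Xx , λ _ → refl))) (+-identityˡ 0#)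

-- Principal ideal domains

-- The ideal {y | y ≈ 0 ∨ P} is principal; its generator g lies in it, and
-- g ≈ 0 refutes P because P would make the ideal contain 1.
pid⇒excluded-middle : ∀ {c ℓ} (R : CommutativeRing c ℓ) → IsPID R → (P : Set (c ⊔ ℓ)) → Dec P
pid⇒excluded-middle R ((1≉0 , _) , principal) P with principal I I-ideal
  where
  open CommutativeRing R
  I : Pred Carrier _
  I y = y ≈ 0# ⊎ P
  I-ideal : IsIdeal R I
  I-ideal = (λ { x≈y (inj₁ x≈0) → inj₁ (trans (sym x≈y) x≈0) ; _ (inj₂ p) → inj₂ p }) ,
            inj₁ refl ,
            (λ { (inj₁ x≈0) (inj₁ y≈0) → inj₁ (trans (+-cong x≈0 y≈0) (+-identityˡ 0#))
               ; (inj₂ p) _ → inj₂ p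
               ; (inj₁ _) (inj₂ p) → inj₂ p }) ,
            (λ { r (inj₁ x≈0) → inj₁ (trans (*-congˡ x≈0) (zeroʳ r)) ; r (inj₂ p) → inj₂ p })
... | g , generates with proj₂ (generates g) (1# , sym (*-identityˡ g))
  where open CommutativeRing R
... | inj₂ p = yes p
... | inj₁ g≈0 = no λ p → let (r , 1≈rg) = proj₁ (generates 1#) (inj₂ p) in
                           1≉0 (trans 1≈rg (trans (*-congˡ g≈0) (zeroʳ r)))
  where open CommutativeRing R

open import Data.Nat using (_+_; _*_)
open import Data.Nat.Solver using (module +-*-Solver)

halve : ∀ a b r → a + (a + 2 * r) ≡ 2 * b → a + r ≡ b
halve a b r a+[a+2r]≡2b = ℕₚ.*-cancelˡ-≡ (a + r) b 2 (≡.trans (double a r) a+[a+2r]≡2b)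
  where
  open +-*-Solver
  double : ∀ a r → 2 * (a + r) ≡ a + (a + 2 * r)
  double = solve 2 (λ a r → con 2 :* (a :+ r) := a :+ (a :+ con 2 :* r)) ≡.refl

lemma4p4 : ∀ {c ℓ : Level} (R : CommutativeRing c ℓ) → IsPID R →
    (m n : ℕ) →
    (B₁ : V R (2 * m) → V R (2 * m) → CommutativeRing.Carrier R) →
    (B₂ : V R (2 * n) → V R (2 * n) → CommutativeRing.Carrier R) →
    IsAltBilinear R (vecOps R (2 * m)) B₁ →
    IsAltBilinear R (vecOps R (2 * n)) B₂ →
    NonDegenerate R (vecOps R (2 * m)) B₁ →
    NonDegenerate R (vecOps R (2 * n)) B₂ →
    NonDegenerate R (pairOps R (2 * m) (2 * n)) (orthSum R B₁ B₂) →
    (X : Pred (V₂ R (2 * m) (2 * n)) _) →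
    MaximalTotallyIsotropic R (pairOps R (2 * m) (2 * n)) (orthSum R B₁ B₂) X →
    (r m₁ n₁ : ℕ) →
    HasRankMod R (image₁ R X) (rad R B₁ (image₁ R X)) (2 * r) →
    HasRankMod R (image₂ R X) (rad R B₂ (image₂ R X)) (2 * r) →
    HasRank R (rad R B₁ (image₁ R X)) m₁ →
    HasRank R (rad R B₂ (image₂ R X)) n₁ →
    (m₁ + r ≡ m) × (n₁ + r ≡ n)
lemma4p4 {c} {ℓ} R pid m n B₁ B₂ alt₁ alt₂ nd₁ nd₂ _ X X-max r m₁ n₁ rank₁ rank₂ rad₁ rad₂ =
  halve m₁ m r (Coisotropic.coisotropic-rank R lem dom alt₁ nd₁ image₁-isSubmodule image₁-coisotropic rank₁ rad₁) ,
  halve n₁ n r (Coisotropic.coisotropic-rank R lem dom alt₂ nd₂ image₂-isSubmodule image₂-coisotropic rank₂ rad₂)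
  where
  dom : IsIntegralDomain R
  dom = proj₁ pid
  lem : (P : Set (c ⊔ ℓ)) → Dec P
  lem = pid⇒excluded-middle R pid
  open OrthogonalSum R alt₁ alt₂ X-max
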